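{- Let $u,v\ge 1$ be integers and let $z$ be an indeterminate. For every integer $n\ge 0$ and every $i=1,2,\dots,2^n$: if $c_z^{(u,v)}(n,i)=\dfrac{az+b}{cz+d}$ in $\mathbb{Q}(z)$, where $a,b,c,d$ are nonnegative integers, then \[ c_z^{(u,v)}(n,2^n+1-i)=\frac{dz+\dfrac{cv}{u}}{\dfrac{bu}{v}z+a}. \]
   Context: For integers $u,v\ge 1$ and an indeterminate $z$, the $(u,v)$-Calkin–Wilf tree $\mathcal{T}^{(u,v)}(z)$ is the infinite binary tree with root $z$, whose vertices are elements of $\mathbb{Q}(z)$, in which every vertex $w$ has left child $w/(uw+1)$ and right child $w+v$. Rows are numbered from $0$ (row $0$ is the root), so row $n$ has $2^n$ vertices; $c_z^{(u,v)}(n,i)$ denotes the $i$-th vertex from the left in row $n$ (the left and right children of the $k$-th vertex of row $n$ are the $(2k-1)$-th and $2k$-th vertices of row $n+1$). -}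

module Defs where

open import Data.Nat using (ℕ; zero; suc; NonZero) renaming (_+_ to _+ℕ_; _*_ to _*ℕ_)
open import Data.Nat.DivMod using (_/_; _%_)
open import Data.Integer using (+_)
open import Data.Rational using (ℚ; 0ℚ; _+_; _*_) renaming (_/_ to _/ℚ_)
open import Data.Product using (_×_)
open import Relation.Binary.PropositionalEquality using (_≡_)
open import Relation.Nullary using (¬_)

-- An element (p z + q) / (r z + s) of ℚ(z), given by its four rational coefficients.
-- (Every vertex of the (u,v)-Calkin–Wilf tree has this shape.)
record Frac : Set where
  constructor frac
  field
    p q r s : ℚ

open Frac public

ι : ℕ → ℚ
ι n = (+ n) /ℚ 1

WellDefined : Frac → Set
WellDefined f = ¬ (r f ≡ 0ℚ × s f ≡ 0ℚ)

-- f and g denote the same element of ℚ(z): both denominators are nonzero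
-- polynomials and (p z + q)(r' z + s') = (p' z + q')(r z + s) as polynomials
-- in z, i.e. coefficientwise.
infix 4 _≈_
_≈_ : Frac → Frac → Set
f ≈ g =
  WellDefined f × WellDefined g ×
  (p f * r g ≡ p g * r f) ×
  (p f * s g + q f * r g ≡ p g * s f + q g * r f) ×
  (q f * s g ≡ q g * s f)

-- Vertices of the tree, represented by natural-number coefficients (a,b,c,d)
-- standing for (a z + b)/(c z + d).
record Mob : Set where
  constructor mob
  field
    ma mb mc md : ℕ

toFrac : Mob → Frac
toFrac (mob a b c d) = frac (ι a) (ι b) (ι c) (ι d)

root : Mob
root = mob 1 0 0 1

-- left child  w ↦ w / (u w + 1)
leftChild : ℕ → Mob → Mob
leftChild u (mob a b c d) = mob a b (u *ℕ a +ℕ c) (u *ℕ b +ℕ d)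

-- right child  w ↦ w + v
rightChild : ℕ → Mob → Mob
rightChild v (mob a b c d) = mob (a +ℕ v *ℕ c) (b +ℕ v *ℕ d) c d

-- vertex with 0-based position j in row n: the children of the vertex at
-- 0-based position k of row n are at positions 2k (left) and 2k+1 (right).
vtx : ℕ → ℕ → ℕ → ℕ → Mob
vtx u v zero    j = root
vtx u v (suc n) j with j % 2
... | zero  = leftChild  u (vtx u v n (j / 2))
... | suc _ = rightChild v (vtx u v n (j / 2))

-- c_z^{(u,v)}(n,i), 1-based position i (1 ≤ i ≤ 2^n), as an element of ℚ(z)
cz : ℕ → ℕ → ℕ → ℕ → Frac
cz u v n i = toFrac (vtx u v n (i Data.Nat.∸ 1))

{-# OPTIONS --safe #-}
-- On coefficient vectors, the map φ : (az+b)/(cz+d) ↦ (dz + cv/u)/((bu/v)z + a) intertwines the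
-- two child operations: φ(w/(uw+1)) = φ(w) + v. Since the root z is fixed by φ, induction on the
-- row shows that the vertices at positions i and 2^n+1-i have φ-related coefficient vectors.
-- Finally φ respects equality in ℚ(z) as long as the numerator does not vanish, and the leading
-- coefficient a of every vertex is at least 1.
module Submission where

open import Defs
open import Data.Nat using (ℕ; NonZero; _≤_; _^_; _∸_) renaming (_+_ to _+ℕ_; _*_ to _*ℕ_)
open import Data.Integer using (+_)
open import Data.Rational using () renaming (_/_ to _/ℚ_)

open import Data.Nat using (zero; suc; z≤n; s≤s; _<_)
import Data.Nat.Properties as ℕ
open import Data.Nat.DivMod using (_/_; _%_; m*n%n≡0; m*n/n≡m; [m+kn]%n≡m%n; +-distrib-/-∣ʳ)
open import Data.Nat.Divisibility using (n∣m*n)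
open import Data.Nat.Tactic.RingSolver using (solve-∀)
import Data.Integer as ℤ
import Data.Integer.Properties as ℤ
open import Data.Rational using (ℚ; 0ℚ; 1ℚ; _+_; _*_; 1/_; toℚᵘ; fromℚᵘ; ≢-nonZero)
open import Data.Rational.Properties
  using (*-comm; *-assoc; *-identityˡ; *-identityʳ; *-zeroˡ; *-zeroʳ; +-identityʳ; *-inverseˡ;
         toℚᵘ-homo-*; toℚᵘ-fromℚᵘ; fromℚᵘ-toℚᵘ; fromℚᵘ-cong; fromℚᵘ-injective)
open import Data.Rational.Solver using (module +-*-Solver)
import Data.Rational.Unnormalised as ℚᵘ
import Data.Rational.Unnormalised.Properties as ℚᵘ
open import Data.Product using (_×_; _,_)
open import Relation.Nullary using (¬_)
open import Data.Empty using (⊥-elim)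
open import Relation.Binary.PropositionalEquality

ι-injective : ∀ {m n} → ι m ≡ ι n → m ≡ n
ι-injective {m} {n} ιm≡ιn with fromℚᵘ-injective {ℚᵘ.mkℚᵘ (+ m) 0} {ℚᵘ.mkℚᵘ (+ n) 0} ιm≡ιn
... | ℚᵘ.*≡* m*1≡n*1 = ℤ.+-injective (subst₂ _≡_ (ℤ.*-identityʳ (+ m)) (ℤ.*-identityʳ (+ n)) m*1≡n*1)

ι≢0 : ∀ {m} → 1 ≤ m → ι m ≢ 0ℚ
ι≢0 {suc m} _ ιm≡0 = ℕ.1+n≢0 (ι-injective {suc m} {0} ιm≡0)

m/d*n/e≡o/f : ∀ m n o d e f .{{_ : NonZero d}} .{{_ : NonZero e}} .{{_ : NonZero f}} →
              m *ℕ n *ℕ f ≡ o *ℕ (d *ℕ e) → ((+ m) /ℚ d) * ((+ n) /ℚ e) ≡ (+ o) /ℚ f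
m/d*n/e≡o/f m n o d@(suc _) e@(suc _) f@(suc _) mnf≡ode = begin
  x * y                                 ≡⟨ fromℚᵘ-toℚᵘ (x * y) ⟨
  fromℚᵘ (toℚᵘ (x * y))                 ≡⟨ fromℚᵘ-cong toℚᵘ[x*y]≃ ⟩
  fromℚᵘ ((+ m ℤ.* + n) ℚᵘ./ (d *ℕ e))  ≡⟨ fromℚᵘ-cong {(+ m ℤ.* + n) ℚᵘ./ (d *ℕ e)} {(+ o) ℚᵘ./ f} (ℚᵘ.*≡* cross) ⟩
  (+ o) /ℚ f                            ∎
  where
  open ≡-Reasoning
  x = (+ m) /ℚ d
  y = (+ n) /ℚ e
  toℚᵘ[x*y]≃ : toℚᵘ (x * y) ℚᵘ.≃ ((+ m ℤ.* + n) ℚᵘ./ (d *ℕ e))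
  toℚᵘ[x*y]≃ = ℚᵘ.≃-trans (toℚᵘ-homo-* x y) (ℚᵘ.*-cong (toℚᵘ-fromℚᵘ ((+ m) ℚᵘ./ d)) (toℚᵘ-fromℚᵘ ((+ n) ℚᵘ./ e)))
  cross : (+ m ℤ.* + n) ℤ.* + f ≡ + o ℤ.* + (d *ℕ e)
  cross = begin
    (+ m ℤ.* + n) ℤ.* + f  ≡⟨ cong (ℤ._* + f) (ℤ.pos-* m n) ⟨
    + (m *ℕ n) ℤ.* + f     ≡⟨ ℤ.pos-* (m *ℕ n) f ⟨
    + (m *ℕ n *ℕ f)        ≡⟨ cong +_ mnf≡ode ⟩
    + (o *ℕ (d *ℕ e))      ≡⟨ ℤ.pos-* o (d *ℕ e) ⟩
    + o ℤ.* + (d *ℕ e)     ∎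

ι*n/d≡[m*n]/d : ∀ m n d .{{_ : NonZero d}} → ι m * ((+ n) /ℚ d) ≡ (+ (m *ℕ n)) /ℚ d
ι*n/d≡[m*n]/d m n d = m/d*n/e≡o/f m n (m *ℕ n) 1 d d (cong (m *ℕ n *ℕ_) (sym (ℕ.*-identityˡ d)))

ι*n/d≡ι : ∀ x y n d .{{_ : NonZero d}} → d *ℕ x ≡ n *ℕ y → ι y * ((+ n) /ℚ d) ≡ ι x
ι*n/d≡ι x y n d dx≡ny = m/d*n/e≡o/f y n x 1 d 1 (begin
  y *ℕ n *ℕ 1     ≡⟨ ℕ.*-identityʳ (y *ℕ n) ⟩
  y *ℕ n          ≡⟨ ℕ.*-comm y n ⟩
  n *ℕ y          ≡⟨ dx≡ny ⟨
  d *ℕ x          ≡⟨ ℕ.*-comm d x ⟩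
  x *ℕ d          ≡⟨ cong (x *ℕ_) (ℕ.*-identityˡ d) ⟨
  x *ℕ (1 *ℕ d)   ∎)
  where open ≡-Reasoning

n/d*d/n≡1 : ∀ n d .{{_ : NonZero n}} .{{_ : NonZero d}} → ((+ n) /ℚ d) * ((+ d) /ℚ n) ≡ 1ℚ
n/d*d/n≡1 n d = m/d*n/e≡o/f n d 1 d n 1 (trans (ℕ.*-identityʳ (n *ℕ d)) (trans (ℕ.*-comm n d) (sym (ℕ.*-identityˡ (d *ℕ n)))))

x≢0⇒x*y≡0⇒y≡0 : ∀ {x y} → x ≢ 0ℚ → x * y ≡ 0ℚ → y ≡ 0ℚ
x≢0⇒x*y≡0⇒y≡0 {x} {y} x≢0 xy≡0 = begin
  y               ≡⟨ *-identityˡ y ⟨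
  1ℚ * y          ≡⟨ cong (_* y) (*-inverseˡ x) ⟨
  (1/ x * x) * y  ≡⟨ *-assoc (1/ x) x y ⟩
  1/ x * (x * y)  ≡⟨ cong (1/ x *_) xy≡0 ⟩
  1/ x * 0ℚ       ≡⟨ *-zeroʳ (1/ x) ⟩
  0ℚ              ∎
  where
  open ≡-Reasoning
  instance _ = ≢-nonZero x≢0

≈⇒numerator≢0 : ∀ f g → p f ≢ 0ℚ → f ≈ g → ¬ (p g ≡ 0ℚ × q g ≡ 0ℚ)
≈⇒numerator≢0 f g pf≢0 (_ , wg , e₁ , e₂ , _) (pg≡0 , qg≡0) = wg (rg≡0 , sg≡0)
  where
  open ≡-Reasoning
  rg≡0 : r g ≡ 0ℚ
  rg≡0 = x≢0⇒x*y≡0⇒y≡0 pf≢0 (trans e₁ (trans (cong (_* r f) pg≡0) (*-zeroˡ (r f))))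
  sg≡0 : s g ≡ 0ℚ
  sg≡0 = x≢0⇒x*y≡0⇒y≡0 pf≢0 (begin
    p f * s g              ≡⟨ +-identityʳ (p f * s g) ⟨
    p f * s g + 0ℚ         ≡⟨ cong (_+_ (p f * s g)) (trans (cong (q f *_) rg≡0) (*-zeroʳ (q f))) ⟨
    p f * s g + q f * r g  ≡⟨ e₂ ⟩
    p g * s f + q g * r f  ≡⟨ cong₂ (λ x y → x * s f + y * r f) pg≡0 qg≡0 ⟩
    0ℚ * s f + 0ℚ * r f    ≡⟨ cong₂ _+_ (*-zeroˡ (s f)) (*-zeroˡ (r f)) ⟩
    0ℚ + 0ℚ                ≡⟨ +-identityʳ 0ℚ ⟩
    0ℚ                     ∎)

-- With k = v/u and l = u/v this is (az+b)/(cz+d) ↦ (dz + cv/u)/((bu/v)z + a).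
mirror : ℚ → ℚ → Frac → Frac
mirror k l f = frac (s f) (r f * k) (q f * l) (p f)

mirror-cong : ∀ k l f g → k * l ≡ 1ℚ → p f ≢ 0ℚ → f ≈ g → mirror k l f ≈ mirror k l g
mirror-cong k l f g kl≡1 pf≢0 f≈g@(_ , _ , e₁ , e₂ , e₃) =
  (λ (_ , pf≡0) → pf≢0 pf≡0) , mirror-g-wellDefined , e₁′ , e₂′ , e₃′
  where
  open ≡-Reasoning
  open +-*-Solver using (solve; _:*_; _:=_)

  rotateʳ : ∀ x y z → x * (y * z) ≡ (y * x) * z
  rotateʳ = solve 3 (λ x y z → x :* (y :* z) := (y :* x) :* z) refl

  rotateˡ : ∀ x y z → (x * z) * y ≡ (y * x) * z
  rotateˡ = solve 3 (λ x y z → (x :* z) :* y := (y :* x) :* z) refl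

  scale : ∀ x y → (x * k) * (y * l) ≡ y * x
  scale x y = begin
    (x * k) * (y * l)  ≡⟨ solve 4 (λ x y k l → (x :* k) :* (y :* l) := (y :* x) :* (k :* l)) refl x y k l ⟩
    (y * x) * (k * l)  ≡⟨ cong ((y * x) *_) kl≡1 ⟩
    (y * x) * 1ℚ       ≡⟨ *-identityʳ (y * x) ⟩
    y * x              ∎

  mirror-g-wellDefined : WellDefined (mirror k l g)
  mirror-g-wellDefined (qg*l≡0 , pg≡0) = ≈⇒numerator≢0 f g pf≢0 f≈g (pg≡0 , qg≡0)
    where
    qg≡0 : q g ≡ 0ℚ
    qg≡0 = begin
      q g            ≡⟨ *-identityʳ (q g) ⟨
      q g * 1ℚ       ≡⟨ cong (q g *_) kl≡1 ⟨
      q g * (k * l)  ≡⟨ rotateʳ (q g) k l ⟩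
      (k * q g) * l  ≡⟨ *-assoc k (q g) l ⟩
      k * (q g * l)  ≡⟨ cong (k *_) qg*l≡0 ⟩
      k * 0ℚ         ≡⟨ *-zeroʳ k ⟩
      0ℚ             ∎

  e₁′ : s f * (q g * l) ≡ s g * (q f * l)
  e₁′ = begin
    s f * (q g * l)  ≡⟨ rotateʳ (s f) (q g) l ⟩
    (q g * s f) * l  ≡⟨ cong (_* l) e₃ ⟨
    (q f * s g) * l  ≡⟨ rotateʳ (s g) (q f) l ⟨
    s g * (q f * l)  ∎

  e₂′ : s f * p g + (r f * k) * (q g * l) ≡ s g * p f + (r g * k) * (q f * l)
  e₂′ = begin
    s f * p g + (r f * k) * (q g * l)  ≡⟨ cong (_+_ (s f * p g)) (scale (r f) (q g)) ⟩
    s f * p g + q g * r f              ≡⟨ cong (_+ q g * r f) (*-comm (s f) (p g)) ⟩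
    p g * s f + q g * r f              ≡⟨ e₂ ⟨
    p f * s g + q f * r g              ≡⟨ cong (_+ q f * r g) (*-comm (p f) (s g)) ⟩
    s g * p f + q f * r g              ≡⟨ cong (_+_ (s g * p f)) (scale (r g) (q f)) ⟨
    s g * p f + (r g * k) * (q f * l)  ∎

  e₃′ : (r f * k) * p g ≡ (r g * k) * p f
  e₃′ = begin
    (r f * k) * p g  ≡⟨ rotateˡ (r f) (p g) k ⟩
    (p g * r f) * k  ≡⟨ cong (_* k) e₁ ⟨
    (p f * r g) * k  ≡⟨ rotateˡ (r g) (p f) k ⟨
    (r g * k) * p f  ∎

-- M′ is the mirror image of M in the sense of mirror (v/u) (u/v), with the divisions cleared.
record Mirrored (u v : ℕ) (M M′ : Mob) : Set where
  field
    ma′≡md : Mob.ma M′ ≡ Mob.md M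
    md′≡ma : Mob.md M′ ≡ Mob.ma M
    u*mb′≡v*mc : u *ℕ Mob.mb M′ ≡ v *ℕ Mob.mc M
    v*mc′≡u*mb : v *ℕ Mob.mc M′ ≡ u *ℕ Mob.mb M

module _ {u v : ℕ} where

  Mirrored-sym : ∀ {M M′} → Mirrored u v M M′ → Mirrored u v M′ M
  Mirrored-sym m = record
    { ma′≡md = sym md′≡ma ; md′≡ma = sym ma′≡md ; u*mb′≡v*mc = sym v*mc′≡u*mb ; v*mc′≡u*mb = sym u*mb′≡v*mc }
    where open Mirrored m

  root-mirrored : Mirrored u v root root
  root-mirrored = record
    { ma′≡md = refl ; md′≡ma = refl
    ; u*mb′≡v*mc = trans (ℕ.*-zeroʳ u) (sym (ℕ.*-zeroʳ v))
    ; v*mc′≡u*mb = trans (ℕ.*-zeroʳ v) (sym (ℕ.*-zeroʳ u)) }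

  leftChild-rightChild-mirrored : ∀ {M M′} → Mirrored u v M M′ → Mirrored u v (leftChild u M) (rightChild v M′)
  leftChild-rightChild-mirrored {mob A B C D} {mob _ B′ _ D′} m = record
    { ma′≡md = trans (cong₂ _+ℕ_ ma′≡md v*mc′≡u*mb) (ℕ.+-comm D (u *ℕ B))
    ; md′≡ma = md′≡ma
    ; u*mb′≡v*mc = begin
        u *ℕ (B′ +ℕ v *ℕ D′)          ≡⟨ ℕ.*-distribˡ-+ u B′ (v *ℕ D′) ⟩
        u *ℕ B′ +ℕ u *ℕ (v *ℕ D′)     ≡⟨ cong₂ _+ℕ_ u*mb′≡v*mc (cong (λ t → u *ℕ (v *ℕ t)) md′≡ma) ⟩
        v *ℕ C +ℕ u *ℕ (v *ℕ A)       ≡⟨ factor-v u v A C ⟩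
        v *ℕ (u *ℕ A +ℕ C)            ∎
    ; v*mc′≡u*mb = v*mc′≡u*mb }
    where
    open Mirrored m
    open ≡-Reasoning
    factor-v : ∀ u v a c → v *ℕ c +ℕ u *ℕ (v *ℕ a) ≡ v *ℕ (u *ℕ a +ℕ c)
    factor-v = solve-∀

data ParityView : ℕ → Set where
  even : ∀ k → ParityView (k *ℕ 2)
  odd  : ∀ k → ParityView (suc (k *ℕ 2))

parityView : ∀ n → ParityView n
parityView zero = even 0
parityView (suc n) with parityView n
... | even k = odd k
... | odd k  = even (suc k)

odd≢even : ∀ k m → suc (k *ℕ 2) ≢ m *ℕ 2
odd≢even zero    zero    ()
odd≢even zero    (suc m) ()
odd≢even (suc k) zero    ()
odd≢even (suc k) (suc m) eq = odd≢even k m (ℕ.suc-injective (ℕ.suc-injective eq))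

module _ (u v : ℕ) where

  vtx-even : ∀ n k → vtx u v (suc n) (k *ℕ 2) ≡ leftChild u (vtx u v n k)
  vtx-even n k rewrite m*n%n≡0 k 2 {{_}} | m*n/n≡m k 2 {{_}} = refl

  vtx-odd : ∀ n k → vtx u v (suc n) (suc (k *ℕ 2)) ≡ rightChild v (vtx u v n k)
  vtx-odd n k rewrite [m+kn]%n≡m%n 1 k 2 {{_}} | +-distrib-/-∣ʳ 1 {{_}} (n∣m*n k {2}) | m*n/n≡m k 2 {{_}} = refl

  vtx-ma-pos : ∀ n j → 1 ≤ Mob.ma (vtx u v n j)
  vtx-ma-pos zero    j = s≤s z≤n
  vtx-ma-pos (suc n) j with j % 2
  ... | zero  = vtx-ma-pos n (j / 2)
  ... | suc _ = ℕ.≤-trans (vtx-ma-pos n (j / 2)) (ℕ.m≤m+n _ _)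

  vtx-mirrored : ∀ n j j′ → suc j +ℕ j′ ≡ 2 ^ n → Mirrored u v (vtx u v n j) (vtx u v n j′)
  vtx-mirrored zero    zero    zero    _ = root-mirrored
  vtx-mirrored zero    zero    (suc _) ()
  vtx-mirrored zero    (suc _) _       ()
  vtx-mirrored (suc n) j j′ = children (parityView j) (parityView j′)
    where
    doubled : ∀ {x y} → x ≡ y → y ≡ 2 *ℕ 2 ^ n → x ≡ 2 ^ n *ℕ 2
    doubled x≡y y≡2N = trans x≡y (trans y≡2N (ℕ.*-comm 2 (2 ^ n)))
    halve : ∀ {x y} → x *ℕ 2 ≡ y → y ≡ 2 *ℕ 2 ^ n → x ≡ 2 ^ n
    halve x*2≡y y≡2N = ℕ.*-cancelʳ-≡ _ _ 2 (doubled x*2≡y y≡2N)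
    even+even : ∀ k k′ → 1 +ℕ (k +ℕ k′) *ℕ 2 ≡ 1 +ℕ k *ℕ 2 +ℕ k′ *ℕ 2
    even+even = solve-∀
    odd+odd : ∀ k k′ → 1 +ℕ (1 +ℕ k +ℕ k′) *ℕ 2 ≡ 2 +ℕ k *ℕ 2 +ℕ (1 +ℕ k′ *ℕ 2)
    odd+odd = solve-∀
    even+odd : ∀ k k′ → (1 +ℕ k +ℕ k′) *ℕ 2 ≡ 1 +ℕ k *ℕ 2 +ℕ (1 +ℕ k′ *ℕ 2)
    even+odd = solve-∀
    odd+even : ∀ k k′ → (1 +ℕ k′ +ℕ k) *ℕ 2 ≡ 2 +ℕ k *ℕ 2 +ℕ k′ *ℕ 2
    odd+even = solve-∀

    children : ∀ {j j′} → ParityView j → ParityView j′ → suc j +ℕ j′ ≡ 2 ^ suc n →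
               Mirrored u v (vtx u v (suc n) j) (vtx u v (suc n) j′)
    children (even k) (even k′) sum≡ = ⊥-elim (odd≢even (k +ℕ k′) (2 ^ n) (doubled (even+even k k′) sum≡))
    children (odd k)  (odd k′)  sum≡ = ⊥-elim (odd≢even (suc (k +ℕ k′)) (2 ^ n) (doubled (odd+odd k k′) sum≡))
    children (even k) (odd k′)  sum≡ rewrite vtx-even n k | vtx-odd n k′ =
      leftChild-rightChild-mirrored (vtx-mirrored n k k′ (halve (even+odd k k′) sum≡))
    children (odd k)  (even k′) sum≡ rewrite vtx-odd n k | vtx-even n k′ =
      Mirrored-sym (leftChild-rightChild-mirrored (vtx-mirrored n k′ k (halve (odd+even k k′) sum≡)))

frac-cong : ∀ {p p′ q q′ r r′ s s′} → p ≡ p′ → q ≡ q′ → r ≡ r′ → s ≡ s′ → frac p q r s ≡ frac p′ q′ r′ s′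
frac-cong refl refl refl refl = refl

toFrac-mirrored : ∀ {u v M M′} .{{_ : NonZero u}} .{{_ : NonZero v}} → Mirrored u v M M′ →
                  toFrac M′ ≡ mirror ((+ v) /ℚ u) ((+ u) /ℚ v) (toFrac M)
toFrac-mirrored {u} {v} {M} {M′} m =
  frac-cong (cong ι ma′≡md) (sym (ι*n/d≡ι (Mob.mb M′) (Mob.mc M) v u u*mb′≡v*mc))
            (sym (ι*n/d≡ι (Mob.mc M′) (Mob.mb M) u v v*mc′≡u*mb)) (cong ι md′≡ma)
  where open Mirrored m

mirror-index : ∀ {j N} → j < N → suc j +ℕ (N +ℕ 1 ∸ suc j ∸ 1) ≡ N
mirror-index {j} {N} j<N = begin
  suc j +ℕ (N +ℕ 1 ∸ suc j ∸ 1)  ≡⟨ cong (λ t → suc j +ℕ (t ∸ suc j ∸ 1)) (ℕ.+-comm N 1) ⟩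
  suc j +ℕ (N ∸ j ∸ 1)           ≡⟨ cong (suc j +ℕ_) (ℕ.∸-+-assoc N j 1) ⟩
  suc j +ℕ (N ∸ (j +ℕ 1))        ≡⟨ cong (λ t → suc j +ℕ (N ∸ t)) (ℕ.+-comm j 1) ⟩
  suc j +ℕ (N ∸ suc j)           ≡⟨ ℕ.m+[n∸m]≡n j<N ⟩
  N                              ∎
  where open ≡-Reasoning

theorem4p2 : (u v : ℕ) → .{{_ : NonZero u}} → .{{_ : NonZero v}} →
    (n i : ℕ) → 1 ≤ i → i ≤ 2 ^ n →
    (a b c d : ℕ) →
    cz u v n i ≈ frac (ι a) (ι b) (ι c) (ι d) →
    cz u v n (2 ^ n +ℕ 1 ∸ i) ≈ frac (ι d) ((+ (c *ℕ v)) /ℚ u) ((+ (b *ℕ u)) /ℚ v) (ι a)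
theorem4p2 u v n (suc j) _ j<2^n a b c d cz≈abcd =
  subst₂ _≈_ (sym (toFrac-mirrored mirrored)) mirror-abcd
    (mirror-cong k l (toFrac (vtx u v n j)) abcd (n/d*d/n≡1 v u) (ι≢0 (vtx-ma-pos u v n j)) cz≈abcd)
  where
  k l : ℚ
  k = (+ v) /ℚ u
  l = (+ u) /ℚ v
  abcd : Frac
  abcd = frac (ι a) (ι b) (ι c) (ι d)
  mirrored : Mirrored u v (vtx u v n j) (vtx u v n (2 ^ n +ℕ 1 ∸ suc j ∸ 1))
  mirrored = vtx-mirrored u v n j _ (mirror-index j<2^n)
  mirror-abcd : mirror k l abcd
              ≡ frac (ι d) ((+ (c *ℕ v)) /ℚ u) ((+ (b *ℕ u)) /ℚ v) (ι a)
  mirror-abcd = cong₂ (λ x y → frac (ι d) x y (ι a)) (ι*n/d≡[m*n]/d c v u) (ι*n/d≡[m*n]/d b u v)
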